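{- Let $a,b$ be integers and $n$ a positive integer. Then the lattice width of the tetrahedron $T_{a,b,n}$ is at most $2\lceil n^{1/3}\rceil$.
   Context: $T_{a,b,n}$ is the tetrahedron with vertices $(0,0,0),(1,0,0),(0,1,0),(a,b,n)$ (no cleanness assumption). For a lattice polytope $S\subset\mathbb{R}^3$ and $u\in\mathbb{Z}^3$, the $u$-width of $S$ is $\max\{u\cdot x:x\in S\}-\min\{u\cdot x:x\in S\}$, and the lattice width of $S$ is the minimum of the $u$-widths over all $u\in\mathbb{Z}^3\setminus\{0\}$. -}

module Defs where

open import Data.Nat as ℕ using (ℕ)
open import Data.Integer using (ℤ; +_; _+_; _-_; _*_; _⊔_; _⊓_; _≤_; 0ℤ)
open import Data.Product using (_×_; _,_; Σ; ∃)
open import Data.Vec using (Vec; []; _∷_; foldr₁)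
open import Relation.Nullary using (¬_)
open import Relation.Binary.PropositionalEquality using (_≡_)

record ℤ³ : Set where
  constructor ⟨_,_,_⟩
  field
    x y z : ℤ

zero³ : ℤ³
zero³ = ⟨ 0ℤ , 0ℤ , 0ℤ ⟩

_·_ : ℤ³ → ℤ³ → ℤ
⟨ a , b , c ⟩ · ⟨ d , e , f ⟩ = a * d + b * e + c * f

-- A lattice polytope given as the convex hull of a nonempty list of lattice points.
-- The maximum (minimum) of a linear functional over conv(V) is attained at a point of V,
-- so the u-width of conv(V) is max_{v∈V} u·v − min_{v∈V} u·v.
uWidth : ∀ {k} → Vec ℤ³ (ℕ.suc k) → ℤ³ → ℤ
uWidth vs u = foldr₁ _⊔_ (Data.Vec.map (u ·_) vs) - foldr₁ _⊓_ (Data.Vec.map (u ·_) vs)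

-- "lattice width of conv(V) ≤ K": the minimum of the u-widths over nonzero u ∈ ℤ³
-- (which is attained, widths being nonnegative integers) is ≤ K, i.e. some nonzero u
-- has u-width ≤ K.
LatticeWidth≤ : ∀ {k} → Vec ℤ³ (ℕ.suc k) → ℤ → Set
LatticeWidth≤ vs K = Σ ℤ³ λ u → ¬ (u ≡ zero³) × uWidth vs u ≤ K

T : ℤ → ℤ → ℤ → Vec ℤ³ 4
T a b n = ⟨ 0ℤ , 0ℤ , 0ℤ ⟩ ∷ ⟨ + 1 , 0ℤ , 0ℤ ⟩ ∷ ⟨ 0ℤ , + 1 , 0ℤ ⟩ ∷ ⟨ a , b , n ⟩ ∷ []

IsCeilCbrt : ℕ → ℕ → Set
IsCeilCbrt n c = (n ℕ.≤ c ℕ.^ 3) × (∀ m → n ℕ.≤ m ℕ.^ 3 → c ℕ.≤ m)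

{-# OPTIONS --safe #-}
-- Dirichlet's pigeonhole argument. The residues (p a + q b) mod n of the (c+1)² points
-- (p , q) ∈ [0,c]² lie in [0, c³), which splits into c² blocks of length c, so two points
-- (p , q) ≠ (p′ , q′) have residues in the same block. Their difference, completed by the
-- matching multiple of n, is a nonzero u ∈ ℤ³ with u·v ∈ [-c, c] at all four vertices v.
module Submission where

open import Defs
open import Data.Nat using (ℕ; NonZero)
open import Data.Integer using (ℤ; +_)
open import Data.Nat as ℕ using (suc; _^_; _/_; _%_)
import Data.Nat.Properties as ℕ
open import Data.Nat.DivMod using (m≡m%n+[m/n]*n; m%n<n; m<n*o⇒m/o<n)
open import Data.Integer as ℤ using (_+_; _*_; _-_; _≤_; _⊔_; _⊓_; -_; 0ℤ)
import Data.Integer.Properties as ℤ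
open import Data.Integer.DivMod using (_%ℕ_; _/ℕ_; n%ℕd<d; a≡a%ℕn+[a/ℕn]*n)
open import Data.Integer.Tactic.RingSolver using (solve-∀)
open import Data.Fin as Fin using (Fin; toℕ; quotient; remainder)
import Data.Fin.Properties as Fin
open import Data.Vec using (Vec; _∷_; []; foldr₁)
open import Data.Vec.Relation.Unary.All as All using (All; _∷_; [])
open import Data.Vec.Relation.Unary.All.Properties using (map⁺)
open import Data.Product using (∃; ∃₂; _×_; _,_; proj₁; proj₂)
open import Relation.Binary.PropositionalEquality
open import Data.Empty using (⊥-elim)

open ℤ³

∣_∣≤_ : ℤ → ℕ → Set
∣ v ∣≤ c = - (+ c) ≤ v × v ≤ + c

∣0∣≤ : ∀ c → ∣ 0ℤ ∣≤ c
∣0∣≤ c = ℤ.neg-≤-pos , ℤ.+≤+ ℕ.z≤n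

∣m-n∣≤ : ∀ {m n c} → m ℕ.≤ c → n ℕ.≤ c → ∣ + m - + n ∣≤ c
∣m-n∣≤ {m} {n} {c} m≤c n≤c = lower , upper
  where
  lower : - (+ c) ≤ + m - + n
  lower = subst (_≤ + m - + n) (ℤ.+-identityˡ (- (+ c)))
            (ℤ.+-mono-≤ (ℤ.+≤+ ℕ.z≤n) (ℤ.neg-mono-≤ (ℤ.+≤+ n≤c)))
  upper : + m - + n ≤ + c
  upper = ℤ.≤-trans (ℤ.i-j≤i (+ m) (+ n)) (ℤ.+≤+ m≤c)

/-≡⇒∣-∣≤ : ∀ {m n c} .{{_ : NonZero c}} → m / c ≡ n / c → ∣ + m - + n ∣≤ c
/-≡⇒∣-∣≤ {m} {n} {c} m/c≡n/c =
  subst (∣_∣≤ c) (sym +m-+n≡) (∣m-n∣≤ (ℕ.<⇒≤ (m%n<n m c)) (ℕ.<⇒≤ (m%n<n n c)))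
  where
  shift : ∀ i j k → (i + k) - (j + k) ≡ i - j
  shift = solve-∀
  +m-+n≡ : + m - + n ≡ + (m % c) - + (n % c)
  +m-+n≡ = begin
    + m - + n
      ≡⟨ cong₂ (λ i j → + i - + j) (m≡m%n+[m/n]*n m c) (m≡m%n+[m/n]*n n c) ⟩
    + (m % c ℕ.+ (m / c) ℕ.* c) - + (n % c ℕ.+ (n / c) ℕ.* c)
      ≡⟨ cong (λ q → + (m % c ℕ.+ q ℕ.* c) - + (n % c ℕ.+ (n / c) ℕ.* c)) m/c≡n/c ⟩
    + (m % c ℕ.+ (n / c) ℕ.* c) - + (n % c ℕ.+ (n / c) ℕ.* c)
      ≡⟨ shift (+ (m % c)) (+ (n % c)) (+ ((n / c) ℕ.* c)) ⟩
    + (m % c) - + (n % c) ∎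
    where open ≡-Reasoning

pigeonhole-∣-∣≤ : ∀ {m k c} .{{_ : NonZero c}} (f : Fin m → ℕ) →
  (∀ i → f i ℕ.< k ℕ.* c) → k ℕ.< m → ∃₂ λ i j → i ≢ j × ∣ + f i - + f j ∣≤ c
pigeonhole-∣-∣≤ {m} {k} {c} f f<kc k<m with Fin.pigeonhole k<m block
  where
  block : Fin m → Fin k
  block i = Fin.fromℕ< (m<n*o⇒m/o<n (f<kc i))
... | i , j , i<j , same-block = i , j , Fin.<⇒≢ i<j , /-≡⇒∣-∣≤ f[i]/c≡f[j]/c
  where
  f[i]/c≡f[j]/c : f i / c ≡ f j / c
  f[i]/c≡f[j]/c = trans (sym (Fin.toℕ-fromℕ< _)) (trans (cong toℕ same-block) (Fin.toℕ-fromℕ< _))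

foldr₁-⊔-lub : ∀ {k} {xs : Vec ℤ (suc k)} {m} → All (_≤ m) xs → foldr₁ _⊔_ xs ≤ m
foldr₁-⊔-lub (x≤m ∷ [])          = x≤m
foldr₁-⊔-lub (x≤m ∷ xs≤m@(_ ∷ _)) = ℤ.⊔-lub x≤m (foldr₁-⊔-lub xs≤m)

foldr₁-⊓-glb : ∀ {k} {xs : Vec ℤ (suc k)} {m} → All (m ≤_) xs → m ≤ foldr₁ _⊓_ xs
foldr₁-⊓-glb (m≤x ∷ [])          = m≤x
foldr₁-⊓-glb (m≤x ∷ m≤xs@(_ ∷ _)) = ℤ.⊓-glb m≤x (foldr₁-⊓-glb m≤xs)

uWidth-≤ : ∀ {k} (vs : Vec ℤ³ (suc k)) (u : ℤ³) (c : ℕ) →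
  All (λ v → ∣ u · v ∣≤ c) vs → uWidth vs u ≤ + (2 ℕ.* c)
uWidth-≤ vs u c bounded = subst (uWidth vs u ≤_) c+c≡2c
  (ℤ.+-mono-≤ (foldr₁-⊔-lub (map⁺ (All.map proj₂ bounded)))
              (ℤ.neg-mono-≤ (foldr₁-⊓-glb (map⁺ (All.map proj₁ bounded)))))
  where
  c+c≡2c : + c + - - (+ c) ≡ + (2 ℕ.* c)
  c+c≡2c = begin
    + c + - - (+ c) ≡⟨ cong (_+_ (+ c)) (ℤ.neg-involutive (+ c)) ⟩
    + (c ℕ.+ c)       ≡⟨ cong (λ d → + (c ℕ.+ d)) (sym (ℕ.+-identityʳ c)) ⟩
    + (2 ℕ.* c)       ∎
    where open ≡-Reasoning

·-zeroʳ : ∀ u → u · zero³ ≡ 0ℤ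
·-zeroʳ ⟨ p , q , r ⟩ = identity p q r
  where
  identity : ∀ p q r → p * 0ℤ + q * 0ℤ + r * 0ℤ ≡ 0ℤ
  identity = solve-∀

·-e₁ : ∀ u → u · ⟨ + 1 , 0ℤ , 0ℤ ⟩ ≡ x u
·-e₁ ⟨ p , q , r ⟩ = identity p q r
  where
  identity : ∀ p q r → p * + 1 + q * 0ℤ + r * 0ℤ ≡ p
  identity = solve-∀

·-e₂ : ∀ u → u · ⟨ 0ℤ , + 1 , 0ℤ ⟩ ≡ y u
·-e₂ ⟨ p , q , r ⟩ = identity p q r
  where
  identity : ∀ p q r → p * 0ℤ + q * + 1 + r * 0ℤ ≡ q
  identity = solve-∀

_-³_ : ℤ³ → ℤ³ → ℤ³
s -³ t = ⟨ x s - x t , y s - y t , z s - z t ⟩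

·-distribʳ--³ : ∀ s t w → (s -³ t) · w ≡ s · w - t · w
·-distribʳ--³ ⟨ p , q , r ⟩ ⟨ p′ , q′ , r′ ⟩ ⟨ a , b , n ⟩ = identity p q r p′ q′ r′ a b n
  where
  identity : ∀ p q r p′ q′ r′ a b n →
    (p - p′) * a + (q - q′) * b + (r - r′) * n ≡ (p * a + q * b + r * n) - (p′ * a + q′ * b + r′ * n)
  identity = solve-∀

Short : ℕ → ℤ³ → ℤ³ → Set
Short c v u = u ≢ zero³ × ∣ x u ∣≤ c × ∣ y u ∣≤ c × ∣ u · v ∣≤ c

uWidth-T≤ : ∀ a b n c u → Short c ⟨ a , b , n ⟩ u → uWidth (T a b n) u ≤ + (2 ℕ.* c)
uWidth-T≤ a b n c u (_ , ∣x∣≤c , ∣y∣≤c , ∣u·v∣≤c) = uWidth-≤ (T a b n) u c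
  ( subst (∣_∣≤ c) (sym (·-zeroʳ u)) (∣0∣≤ c)
  ∷ subst (∣_∣≤ c) (sym (·-e₁ u)) ∣x∣≤c
  ∷ subst (∣_∣≤ c) (sym (·-e₂ u)) ∣y∣≤c
  ∷ ∣u·v∣≤c
  ∷ [])

module Grid (a b : ℤ) (n : ℕ) .{{_ : NonZero n}} (c : ℕ) where

  Point : Set
  Point = Fin (suc c ℕ.* suc c)

  row col : Point → Fin (suc c)
  row = quotient {suc c} (suc c)
  col = remainder {suc c} (suc c)

  row≤ : ∀ i → toℕ (row i) ℕ.≤ c
  row≤ i = ℕ.≤-pred (Fin.toℕ<n (row i))

  col≤ : ∀ i → toℕ (col i) ℕ.≤ c
  col≤ i = ℕ.≤-pred (Fin.toℕ<n (col i))

  row-col-injective : ∀ {i j} → row i ≡ row j → col i ≡ col j → i ≡ j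
  row-col-injective {i} {j} row≡ col≡ = begin
    i                              ≡⟨ Fin.combine-remQuot {suc c} (suc c) i ⟨
    Fin.combine (row i) (col i)    ≡⟨ cong₂ Fin.combine row≡ col≡ ⟩
    Fin.combine (row j) (col j)    ≡⟨ Fin.combine-remQuot {suc c} (suc c) j ⟩
    j                              ∎
    where open ≡-Reasoning

  form : Point → ℤ
  form i = + toℕ (row i) * a + + toℕ (col i) * b

  residue : Point → ℕ
  residue i = form i %ℕ n

  lift : Point → ℤ³
  lift i = ⟨ + toℕ (row i) , + toℕ (col i) , - (form i /ℕ n) ⟩

  lift·≡residue : ∀ i → lift i · ⟨ a , b , + n ⟩ ≡ + residue i
  lift·≡residue i = begin
    form i + - (form i /ℕ n) * + n
      ≡⟨ cong (λ f → f + - (form i /ℕ n) * + n) (a≡a%ℕn+[a/ℕn]*n (form i) n) ⟩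
    + residue i + form i /ℕ n * + n + - (form i /ℕ n) * + n
      ≡⟨ cancel (+ residue i) (form i /ℕ n) (+ n) ⟩
    + residue i ∎
    where
    open ≡-Reasoning
    cancel : ∀ r k d → r + k * d + - k * d ≡ r
    cancel = solve-∀

  difference-short : ∀ {i j} → i ≢ j → ∣ + residue i - + residue j ∣≤ c →
    Short c ⟨ a , b , + n ⟩ (lift i -³ lift j)
  difference-short {i} {j} i≢j ∣rᵢ-rⱼ∣≤c =
    u≢0 , ∣m-n∣≤ (row≤ i) (row≤ j) , ∣m-n∣≤ (col≤ i) (col≤ j) ,
    subst (∣_∣≤ c) (sym u·v≡rᵢ-rⱼ) ∣rᵢ-rⱼ∣≤c
    where
    toℕ-≡ : ∀ {k l : Fin (suc c)} → + toℕ k - + toℕ l ≡ 0ℤ → k ≡ l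
    toℕ-≡ k-l≡0 = Fin.toℕ-injective (ℤ.+-injective (ℤ.i-j≡0⇒i≡j _ _ k-l≡0))
    u≢0 : lift i -³ lift j ≢ zero³
    u≢0 u≡0 = i≢j (row-col-injective (toℕ-≡ (cong x u≡0)) (toℕ-≡ (cong y u≡0)))
    u·v≡rᵢ-rⱼ : (lift i -³ lift j) · ⟨ a , b , + n ⟩ ≡ + residue i - + residue j
    u·v≡rᵢ-rⱼ = trans (·-distribʳ--³ (lift i) (lift j) _)
                      (cong₂ _-_ (lift·≡residue i) (lift·≡residue j))

  short-vector : .{{_ : NonZero c}} → n ℕ.≤ c ^ 3 → ∃ (Short c ⟨ a , b , + n ⟩)
  short-vector n≤c³ =
    let i , j , i≢j , close = pigeonhole-∣-∣≤ residue residue<c²·c c²<[1+c]²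
    in lift i -³ lift j , difference-short i≢j close
    where
    c³≡c²·c : c ^ 3 ≡ c ℕ.* c ℕ.* c
    c³≡c²·c = trans (cong (λ d → c ℕ.* (c ℕ.* d)) (ℕ.*-identityʳ c)) (sym (ℕ.*-assoc c c c))
    residue<c²·c : ∀ i → residue i ℕ.< c ℕ.* c ℕ.* c
    residue<c²·c i = ℕ.<-≤-trans (n%ℕd<d (form i) n) (ℕ.≤-trans n≤c³ (ℕ.≤-reflexive c³≡c²·c))
    c²<[1+c]² : c ℕ.* c ℕ.< suc c ℕ.* suc c
    c²<[1+c]² = ℕ.*-mono-< (ℕ.n<1+n c) (ℕ.n<1+n c)

latticeWidth-T≤ : ∀ (a b : ℤ) (n c : ℕ) .{{_ : NonZero n}} → n ℕ.≤ c ^ 3 →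
  LatticeWidth≤ (T a b (+ n)) (+ (2 ℕ.* c))
latticeWidth-T≤ a b n ℕ.zero n≤0 = ⊥-elim (ℕ.<⇒≱ (ℕ.>-nonZero⁻¹ n) n≤0)
latticeWidth-T≤ a b n c@(suc _) n≤c³ =
  let u , short = Grid.short-vector a b n c n≤c³
  in u , proj₁ short , uWidth-T≤ a b (+ n) c u short

theorem16 : (a b : ℤ) (n : ℕ) → .{{_ : NonZero n}} → (c : ℕ) → IsCeilCbrt n c →
    LatticeWidth≤ (T a b (+ n)) (+ (2 Data.Nat.* c))
theorem16 a b n c (n≤c³ , _) = latticeWidth-T≤ a b n c n≤c³
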